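{- Let $d\ge 2$, let $F(X)=X^d+a_1X^{d-1}+\cdots+a_d\in\mathbb{Z}[X]$ be monic and irreducible, and let $\alpha$ be a root of $F$. Let $I$ be the sublattice of $\mathbb{Z}[\alpha]$ with $\mathbb{Z}$-basis $\{\beta_1,\dots,\beta_d\}$ given by $$\beta_i=\sum_{j=1}^d b_{ij}\alpha^{d-j},\qquad 1\le i\le d,$$ where the integer matrix $B=(b_{ij})_{1\le i,j\le d}$ is in upper-triangular Hermite normal form, meaning $b_{ij}=0$ if $j<i$, $b_{jj}>0$, and $0\le b_{ij}<b_{jj}$ for all $i<j$. If $I$ is an ideal of $\mathbb{Z}[\alpha]$, then $b_{ii}$ divides $b_{ij}$ and $b_{jj}$ for all $1\le i\le j\le d$. In particular, if $I$ is an ideal, then $b_{11},\dots,b_{dd}$ are the invariant factors of the additive group $\mathbb{Z}[\alpha]/I$. -}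

module Defs where

open import Data.Nat using (ℕ; zero; suc)
open import Data.Integer using (ℤ; _+_; _-_; _*_; 0ℤ; 1ℤ)
open import Data.Fin using (Fin; _≟_)
open import Data.Vec using (Vec; []; _∷_; _∷ʳ_; map; zipWith; replicate; tabulate; lookup)
open import Data.List using (List; []; _∷_)
open import Data.List as L using ()
open import Data.Product using (Σ; ∃; _×_; _,_)
open import Data.Bool using (if_then_else_)
open import Relation.Nullary.Decidable using (⌊_⌋)
open import Relation.Binary.PropositionalEquality using (_≡_)

-- Integer polynomials as ascending coefficient lists (constant term first)

addP : List ℤ → List ℤ → List ℤ
addP [] q = q
addP (p ∷ ps) [] = p ∷ ps
addP (p ∷ ps) (q ∷ qs) = (p + q) ∷ addP ps qs

mulP : List ℤ → List ℤ → List ℤ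
mulP [] q = []
mulP (p ∷ ps) q = addP (L.map (p *_) q) (0ℤ ∷ mulP ps q)

monicPoly : ∀ {k} → Vec ℤ k → List ℤ
monicPoly c = L.reverse (1ℤ ∷ Data.Vec.toList c)

-- A monic F ∈ ℤ[X] of degree d is irreducible in ℤ[X] iff it is not a
-- product of two monic integer polynomials of positive degree
-- (F monic ⇒ primitive, so any factorisation into non-units has both
-- factors non-constant, and they can be normalised to be monic).
IrreducibleMonic : ∀ {d} → Vec ℤ d → Set
IrreducibleMonic a =
  (k m : ℕ) (g : Vec ℤ (suc k)) (h : Vec ℤ (suc m)) →
  mulP (monicPoly g) (monicPoly h) ≡ monicPoly a → Data.Empty.⊥
  where import Data.Empty

-- ℤ[α] ≅ ℤ[X]/(F) with ℤ-basis α^(d-1), …, α, 1.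
-- An element is a vector x = (x₀,…,x_{d-1}) standing for Σ_j x_j α^(d-1-j).
-- The coefficient vector a = (a₁,…,a_d) describes F = X^d + a₁X^(d-1)+⋯+a_d.

Vecℤ : ℕ → Set
Vecℤ d = Vec ℤ d

addV : ∀ {d} → Vecℤ d → Vecℤ d → Vecℤ d
addV = zipWith _+_

scaleV : ∀ {d} → ℤ → Vecℤ d → Vecℤ d
scaleV c = map (c *_)

zeroV : ∀ {d} → Vecℤ d
zeroV = replicate _ 0ℤ

-- multiplication by α (using α^d = -(a₁α^(d-1)+⋯+a_d))
mulα : ∀ {d} → Vecℤ d → Vecℤ d → Vecℤ d
mulα a [] = []
mulα a (x₀ ∷ xs) = zipWith (λ xi ai → xi - ai * x₀) (xs ∷ʳ 0ℤ) a

-- r · x in ℤ[α] where r = Σ_j r_j α^(d-1-j), by Horner's scheme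
hornerAcc : ∀ {d n} → Vecℤ d → Vecℤ d → Vecℤ d → Vec ℤ n → Vecℤ d
hornerAcc a x acc [] = acc
hornerAcc a x acc (c ∷ cs) = hornerAcc a x (addV (mulα a acc) (scaleV c x)) cs

mulZα : ∀ {d} → Vecℤ d → Vecℤ d → Vecℤ d → Vecℤ d
mulZα a r x = hornerAcc a x zeroV r

-- Integer matrices as vectors of rows.

Mat : ℕ → Set
Mat d = Vec (Vec ℤ d) d

entry : ∀ {d} → Mat d → Fin d → Fin d → ℤ
entry B i j = lookup (lookup B i) j

linComb : ∀ {m d} → Vec ℤ m → Vec (Vecℤ d) m → Vecℤ d
linComb [] [] = zeroV
linComb (c ∷ cs) (r ∷ rs) = addV (scaleV c r) (linComb cs rs)

InLattice : ∀ {d} → Mat d → Vecℤ d → Set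
InLattice B x = Σ (Vecℤ _) λ c → x ≡ linComb c B

IsIdeal : ∀ {d} → Vecℤ d → Mat d → Set
IsIdeal a B = ∀ r x → InLattice B x → InLattice B (mulZα a r x)

matMul : ∀ {d} → Mat d → Mat d → Mat d
matMul A B = map (λ row → linComb row B) A

identityM : ∀ {d} → Mat d
identityM = tabulate λ i → tabulate λ j → if ⌊ i ≟ j ⌋ then 1ℤ else 0ℤ

diagOf : ∀ {d} → Mat d → Mat d
diagOf B = tabulate λ i → tabulate λ j → if ⌊ i ≟ j ⌋ then entry B i i else 0ℤ

Unimodular : ∀ {d} → Mat d → Set
Unimodular U = Σ (Mat _) λ U' → matMul U U' ≡ identityM × matMul U' U ≡ identityM

{-# OPTIONS --safe #-}
module Submission where

-- Write B as its first row (x, r) above the lower-right minor M.  The ideal property is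
-- only used through closure under α, which on vectors with leading coordinate 0 is the left
-- shift (coordinates refer to α^(d-1), …, α, 1); since x ≠ 0 this closure passes from the
-- lattice of B to that of M.  If M has first row (y, s), the shift (y, s, 0) of the second
-- row of B lies in the lattice; expanding it in the rows of B gives y = c x from the first
-- coordinate, and as y divides every entry of M by induction, y = c x divides c r, so x
-- divides r.  Hence each b_ii divides every entry of rows i, i+1, …, so B = diag(b_ii) N
-- with N upper unitriangular, N is invertible over ℤ, and B N⁻¹ = diag(b_ii).

open import Data.Bool using (Bool; true; false; if_then_else_)
open import Data.Fin using (Fin; zero; suc; toℕ; _≟_)
open import Data.Integer using (ℤ; 0ℤ; 1ℤ; -1ℤ; _+_; _-_; _*_; ≢-nonZero)
open import Data.Integer as Z using ()
import Data.Integer.Properties as ℤ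
open import Algebra.Properties.CommutativeSemigroup ℤ.+-commutativeSemigroup using (interchange)
open import Data.Integer.Divisibility using (_∣_)
open import Data.Integer.Divisibility.Signed as Signed using (divides) renaming (_∣_ to _∣ˢ_)
open import Data.Nat using (ℕ; zero; suc; _≤_; z≤n; s≤s)
open import Data.Nat as N using ()
open import Data.Nat.Properties using (≤-refl)
open import Data.Product using (Σ; _×_; _,_; proj₁; proj₂)
open import Data.Vec using (Vec; []; _∷_; _∷ʳ_; lookup; map; replicate; tail; tabulate; zipWith)
import Data.Vec.Properties as Vec
open import Data.Vec.Relation.Unary.All as All using (All; []; _∷_)
import Data.Vec.Relation.Unary.All.Properties as All
open import Function using (_∘_)
open import Relation.Binary.PropositionalEquality
open import Relation.Nullary.Decidable using (⌊_⌋; yes; no)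
open import Defs

open ≡-Reasoning

lookup-ext : ∀ {A : Set} {n} {u v : Vec A n} → (∀ i → lookup u i ≡ lookup v i) → u ≡ v
lookup-ext {u = u} {v} eq = begin
  u                   ≡⟨ Vec.tabulate∘lookup u ⟨
  tabulate (lookup u) ≡⟨ Vec.tabulate-cong eq ⟩
  tabulate (lookup v) ≡⟨ Vec.tabulate∘lookup v ⟩
  v                   ∎

lookup-map-tail : ∀ {A : Set} {m n} (rows : Vec (Vec A (suc n)) m) i j →
                  lookup (lookup (map tail rows) i) j ≡ lookup (lookup rows i) (suc j)
lookup-map-tail ((_ ∷ _) ∷ _)   zero    j = refl
lookup-map-tail (_ ∷ rows)     (suc i) j = lookup-map-tail rows i j

addV-identityˡ : ∀ {n} (v : Vecℤ n) → addV zeroV v ≡ v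
addV-identityˡ = Vec.zipWith-identityˡ ℤ.+-identityˡ

addV-identityʳ : ∀ {n} (v : Vecℤ n) → addV v zeroV ≡ v
addV-identityʳ = Vec.zipWith-identityʳ ℤ.+-identityʳ

addV-interchange : ∀ {n} (u v w x : Vecℤ n) → addV (addV u v) (addV w x) ≡ addV (addV u w) (addV v x)
addV-interchange []       []       []       []       = refl
addV-interchange (u ∷ us) (v ∷ vs) (w ∷ ws) (x ∷ xs) =
  cong₂ _∷_ (interchange u v w x) (addV-interchange us vs ws xs)

addV-inverseˡ : ∀ {n} (v : Vecℤ n) → addV (scaleV -1ℤ v) v ≡ zeroV
addV-inverseˡ = Vec.zipWith-inverseˡ λ x → trans (cong (_+ x) (ℤ.-1*i≡-i x)) (ℤ.+-inverseˡ x)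

addV-inverseʳ : ∀ {n} (v : Vecℤ n) → addV v (scaleV -1ℤ v) ≡ zeroV
addV-inverseʳ = Vec.zipWith-inverseʳ λ x → trans (cong (x +_) (ℤ.-1*i≡-i x)) (ℤ.+-inverseʳ x)

scaleV-zeroˡ : ∀ {n} (v : Vecℤ n) → scaleV 0ℤ v ≡ zeroV
scaleV-zeroˡ v = trans (Vec.map-cong ℤ.*-zeroˡ v) (Vec.map-const v 0ℤ)

scaleV-zeroʳ : ∀ {n} c → scaleV c (zeroV {n}) ≡ zeroV
scaleV-zeroʳ {zero}  c = refl
scaleV-zeroʳ {suc n} c = cong₂ _∷_ (ℤ.*-zeroʳ c) (scaleV-zeroʳ c)

scaleV-identityˡ : ∀ {n} (v : Vecℤ n) → scaleV 1ℤ v ≡ v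
scaleV-identityˡ v = trans (Vec.map-cong ℤ.*-identityˡ v) (Vec.map-id v)

scaleV-assoc : ∀ {n} c d (v : Vecℤ n) → scaleV (c * d) v ≡ scaleV c (scaleV d v)
scaleV-assoc c d v = trans (Vec.map-cong (ℤ.*-assoc c d) v) (Vec.map-∘ (c *_) (d *_) v)

scaleV-distribˡ : ∀ {n} c (u v : Vecℤ n) → scaleV c (addV u v) ≡ addV (scaleV c u) (scaleV c v)
scaleV-distribˡ c []       []       = refl
scaleV-distribˡ c (x ∷ u) (y ∷ v) = cong₂ _∷_ (ℤ.*-distribˡ-+ c x y) (scaleV-distribˡ c u v)

scaleV-distribʳ : ∀ {n} c d (v : Vecℤ n) → scaleV (c + d) v ≡ addV (scaleV c v) (scaleV d v)
scaleV-distribʳ c d []      = refl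
scaleV-distribʳ c d (x ∷ v) = cong₂ _∷_ (ℤ.*-distribʳ-+ x c d) (scaleV-distribʳ c d v)

linComb-zeroV : ∀ {m d} (M : Vec (Vecℤ d) m) → linComb zeroV M ≡ zeroV
linComb-zeroV []      = refl
linComb-zeroV (r ∷ M) = trans (cong₂ addV (scaleV-zeroˡ r) (linComb-zeroV M)) (addV-identityˡ zeroV)

linComb-head : ∀ {m d} (v : Vecℤ d) (M : Vec (Vecℤ d) m) → linComb (1ℤ ∷ zeroV) (v ∷ M) ≡ v
linComb-head v M = trans (cong₂ addV (scaleV-identityˡ v) (linComb-zeroV M)) (addV-identityʳ v)

linComb-tail : ∀ {m d} (c : Vecℤ m) (v : Vecℤ d) (M : Vec (Vecℤ d) m) →
               linComb (0ℤ ∷ c) (v ∷ M) ≡ linComb c M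
linComb-tail c v M = trans (cong (λ u → addV u (linComb c M)) (scaleV-zeroˡ v)) (addV-identityˡ (linComb c M))

linComb-addV : ∀ {m d} (c c′ : Vecℤ m) (M : Vec (Vecℤ d) m) →
               linComb (addV c c′) M ≡ addV (linComb c M) (linComb c′ M)
linComb-addV []       []        []      = sym (addV-identityˡ zeroV)
linComb-addV (x ∷ c) (y ∷ c′) (r ∷ M) = begin
  addV (scaleV (x + y) r) (linComb (addV c c′) M)
    ≡⟨ cong₂ addV (scaleV-distribʳ x y r) (linComb-addV c c′ M) ⟩
  addV (addV (scaleV x r) (scaleV y r)) (addV (linComb c M) (linComb c′ M))
    ≡⟨ addV-interchange (scaleV x r) (scaleV y r) (linComb c M) (linComb c′ M) ⟩
  addV (linComb (x ∷ c) (r ∷ M)) (linComb (y ∷ c′) (r ∷ M)) ∎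

linComb-scaleV : ∀ {m d} k (c : Vecℤ m) (M : Vec (Vecℤ d) m) → linComb (scaleV k c) M ≡ scaleV k (linComb c M)
linComb-scaleV k []      []      = sym (scaleV-zeroʳ k)
linComb-scaleV k (x ∷ c) (r ∷ M) = begin
  addV (scaleV (k * x) r) (linComb (scaleV k c) M)
    ≡⟨ cong₂ addV (scaleV-assoc k x r) (linComb-scaleV k c M) ⟩
  addV (scaleV k (scaleV x r)) (scaleV k (linComb c M))
    ≡⟨ scaleV-distribˡ k (scaleV x r) (linComb c M) ⟨
  scaleV k (linComb (x ∷ c) (r ∷ M)) ∎

linComb-assoc : ∀ {m p d} (c : Vecℤ m) (M : Vec (Vecℤ p) m) (N : Vec (Vecℤ d) p) →
                linComb (linComb c M) N ≡ linComb c (map (λ row → linComb row N) M)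
linComb-assoc []      []      N = linComb-zeroV N
linComb-assoc (x ∷ c) (v ∷ M) N = begin
  linComb (addV (scaleV x v) (linComb c M)) N
    ≡⟨ linComb-addV (scaleV x v) (linComb c M) N ⟩
  addV (linComb (scaleV x v) N) (linComb (linComb c M) N)
    ≡⟨ cong₂ addV (linComb-scaleV x v N) (linComb-assoc c M N) ⟩
  linComb (x ∷ c) (map (λ row → linComb row N) (v ∷ M)) ∎

linComb-shift : ∀ {m d} (c : Vecℤ m) (M : Vec (Vecℤ d) m) → linComb c (map (0ℤ ∷_) M) ≡ 0ℤ ∷ linComb c M
linComb-shift []      []      = refl
linComb-shift (x ∷ c) (v ∷ M) = begin
  addV (scaleV x (0ℤ ∷ v)) (linComb c (map (0ℤ ∷_) M))
    ≡⟨ cong (addV (scaleV x (0ℤ ∷ v))) (linComb-shift c M) ⟩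
  (x * 0ℤ + 0ℤ) ∷ addV (scaleV x v) (linComb c M)
    ≡⟨ cong (_∷ addV (scaleV x v) (linComb c M)) (trans (ℤ.+-identityʳ (x * 0ℤ)) (ℤ.*-zeroʳ x)) ⟩
  0ℤ ∷ linComb (x ∷ c) (v ∷ M) ∎

upperBlock : ∀ {n} → ℤ → Vecℤ n → Mat n → Mat (suc n)
upperBlock x r M = (x ∷ r) ∷ map (0ℤ ∷_) M

entry-upperBlock-suc : ∀ {n} x r (M : Mat n) i j →
                       entry (upperBlock x r M) (suc i) j ≡ lookup (0ℤ ∷ lookup M i) j
entry-upperBlock-suc x r M i j = cong (λ v → lookup v j) (Vec.lookup-map i (0ℤ ∷_) M)

matMul-upperBlock : ∀ {n} x y (r s : Vecℤ n) (A B : Mat n) →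
  matMul (upperBlock x r A) (upperBlock y s B) ≡
  upperBlock (x * y + 0ℤ) (addV (scaleV x s) (linComb r B)) (matMul A B)
matMul-upperBlock x y r s A B =
  cong₂ _∷_ (cong (addV (scaleV x (y ∷ s))) (linComb-shift r B)) (begin
    map (λ row → linComb row (upperBlock y s B)) (map (0ℤ ∷_) A)
      ≡⟨ Vec.map-∘ _ (0ℤ ∷_) A ⟨
    map (λ row → linComb (0ℤ ∷ row) (upperBlock y s B)) A
      ≡⟨ Vec.map-cong (λ row → trans (linComb-tail row (y ∷ s) (map (0ℤ ∷_) B)) (linComb-shift row B)) A ⟩
    map (λ row → 0ℤ ∷ linComb row B) A
      ≡⟨ Vec.map-∘ (0ℤ ∷_) (λ row → linComb row B) A ⟩
    map (0ℤ ∷_) (matMul A B) ∎)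

δ-suc : ∀ {n} (i j : Fin n) → ⌊ suc i ≟ suc j ⌋ ≡ ⌊ i ≟ j ⌋
δ-suc i j with i ≟ j
... | yes _ = refl
... | no  _ = refl

identityM-upperBlock : ∀ {n} → identityM {suc n} ≡ upperBlock 1ℤ zeroV identityM
identityM-upperBlock {n} =
  cong₂ _∷_ (cong (1ℤ ∷_) (trans (Vec.tabulate-allFin _) (Vec.map-const _ 0ℤ))) rows
  where
  rows : tabulate (λ i → 0ℤ ∷ tabulate λ j → if ⌊ suc i ≟ suc j ⌋ then 1ℤ else 0ℤ) ≡
         map (0ℤ ∷_) identityM
  rows = begin
    tabulate (λ i → 0ℤ ∷ tabulate λ j → if ⌊ suc i ≟ suc j ⌋ then 1ℤ else 0ℤ)
      ≡⟨ Vec.tabulate-cong (λ i → cong (0ℤ ∷_)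
           (Vec.tabulate-cong λ j → cong (if_then 1ℤ else 0ℤ) (δ-suc i j))) ⟩
    tabulate (λ i → 0ℤ ∷ tabulate λ j → if ⌊ i ≟ j ⌋ then 1ℤ else 0ℤ)
      ≡⟨ Vec.tabulate-∘ (0ℤ ∷_) _ ⟩
    map (0ℤ ∷_) identityM ∎

linComb-identityM : ∀ {n} (c : Vecℤ n) → linComb c identityM ≡ c
linComb-identityM []      = refl
linComb-identityM (x ∷ c) = begin
  linComb (x ∷ c) identityM
    ≡⟨ cong (linComb (x ∷ c)) identityM-upperBlock ⟩
  addV (scaleV x (1ℤ ∷ zeroV)) (linComb c (map (0ℤ ∷_) identityM))
    ≡⟨ cong (addV (scaleV x (1ℤ ∷ zeroV))) (linComb-shift c identityM) ⟩
  (x * 1ℤ + 0ℤ) ∷ addV (scaleV x zeroV) (linComb c identityM)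
    ≡⟨ cong₂ _∷_ (trans (ℤ.+-identityʳ (x * 1ℤ)) (ℤ.*-identityʳ x))
                 (trans (cong₂ addV (scaleV-zeroʳ x) (linComb-identityM c)) (addV-identityˡ c)) ⟩
  x ∷ c ∎

linComb-identityRow : ∀ {n d} (i : Fin n) (M : Vec (Vecℤ d) n) → linComb (lookup identityM i) M ≡ lookup M i
linComb-identityRow zero    (v ∷ M) =
  trans (cong (λ I → linComb (lookup I zero) (v ∷ M)) identityM-upperBlock) (linComb-head v M)
linComb-identityRow (suc i) (v ∷ M) = begin
  linComb (lookup identityM (suc i)) (v ∷ M)
    ≡⟨ cong (λ I → linComb (lookup I (suc i)) (v ∷ M)) identityM-upperBlock ⟩
  linComb (lookup (map (0ℤ ∷_) identityM) i) (v ∷ M)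
    ≡⟨ cong (λ c → linComb c (v ∷ M)) (Vec.lookup-map i (0ℤ ∷_) identityM) ⟩
  linComb (0ℤ ∷ lookup identityM i) (v ∷ M)
    ≡⟨ linComb-tail (lookup identityM i) v M ⟩
  linComb (lookup identityM i) M
    ≡⟨ linComb-identityRow i M ⟩
  lookup M i ∎

matMul-identityˡ : ∀ {n} (M : Mat n) → matMul identityM M ≡ M
matMul-identityˡ M = lookup-ext λ i →
  trans (Vec.lookup-map i (λ row → linComb row M) identityM) (linComb-identityRow i M)

data UpperTriangular (P : ℤ → Set) : ∀ {n} → Mat n → Set where
  []  : UpperTriangular P []
  _∷_ : ∀ {n x r} {M : Mat n} → P x → UpperTriangular P M → UpperTriangular P (upperBlock x r M)

upperTriangular : ∀ {P : ℤ → Set} {n} (B : Mat n) →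
  (∀ i j → toℕ j N.< toℕ i → entry B i j ≡ 0ℤ) → (∀ i → P (entry B i i)) → UpperTriangular P B
upperTriangular []               lower diagonal = []
upperTriangular {P} ((x ∷ r) ∷ rows) lower diagonal =
  subst (λ rows → UpperTriangular P ((x ∷ r) ∷ rows))
        (zero-column rows (λ i → lower (suc i) zero (s≤s z≤n)))
    (diagonal zero ∷ upperTriangular (map tail rows)
      (λ i j j<i → trans (lookup-map-tail rows i j) (lower (suc i) (suc j) (s≤s j<i)))
      (λ i → subst P (sym (lookup-map-tail rows i i)) (diagonal (suc i))))
  where
  zero-column : ∀ {m n} (rows : Vec (Vecℤ (suc n)) m) → (∀ i → lookup (lookup rows i) zero ≡ 0ℤ) →
                map (0ℤ ∷_) (map tail rows) ≡ rows
  zero-column []              _      = refl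
  zero-column ((y ∷ v) ∷ rows) head≡0 =
    cong₂ _∷_ (cong (_∷ v) (sym (head≡0 zero))) (zero-column rows (head≡0 ∘ suc))

Unitriangular : ∀ {n} → Mat n → Set
Unitriangular = UpperTriangular (_≡ 1ℤ)

unitriangular⇒unimodular : ∀ {n} {N : Mat n} → Unitriangular N → Unimodular N
unitriangular⇒unimodular []        = [] , refl , refl
unitriangular⇒unimodular (_∷_ {r = r} {M = N′} refl N′-unitriangular)
  with unitriangular⇒unimodular N′-unitriangular
... | M′ , N′M′≡I , M′N′≡I = upperBlock 1ℤ s M′ , NM≡I , MN≡I
  where
  s : Vecℤ _
  s = scaleV -1ℤ (linComb r M′)
  NM≡I : matMul (upperBlock 1ℤ r N′) (upperBlock 1ℤ s M′) ≡ identityM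
  NM≡I = begin
    matMul (upperBlock 1ℤ r N′) (upperBlock 1ℤ s M′)
      ≡⟨ matMul-upperBlock 1ℤ 1ℤ r s N′ M′ ⟩
    upperBlock 1ℤ (addV (scaleV 1ℤ s) (linComb r M′)) (matMul N′ M′)
      ≡⟨ cong₂ (upperBlock 1ℤ)
           (trans (cong (λ u → addV u (linComb r M′)) (scaleV-identityˡ s)) (addV-inverseˡ (linComb r M′)))
           N′M′≡I ⟩
    upperBlock 1ℤ zeroV identityM
      ≡⟨ identityM-upperBlock ⟨
    identityM ∎
  sN′≡-r : linComb s N′ ≡ scaleV -1ℤ r
  sN′≡-r = begin
    linComb (scaleV -1ℤ (linComb r M′)) N′ ≡⟨ linComb-scaleV -1ℤ (linComb r M′) N′ ⟩
    scaleV -1ℤ (linComb (linComb r M′) N′) ≡⟨ cong (scaleV -1ℤ) (linComb-assoc r M′ N′) ⟩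
    scaleV -1ℤ (linComb r (matMul M′ N′))  ≡⟨ cong (λ I → scaleV -1ℤ (linComb r I)) M′N′≡I ⟩
    scaleV -1ℤ (linComb r identityM)       ≡⟨ cong (scaleV -1ℤ) (linComb-identityM r) ⟩
    scaleV -1ℤ r                           ∎
  MN≡I : matMul (upperBlock 1ℤ s M′) (upperBlock 1ℤ r N′) ≡ identityM
  MN≡I = begin
    matMul (upperBlock 1ℤ s M′) (upperBlock 1ℤ r N′)
      ≡⟨ matMul-upperBlock 1ℤ 1ℤ s r M′ N′ ⟩
    upperBlock 1ℤ (addV (scaleV 1ℤ r) (linComb s N′)) (matMul M′ N′)
      ≡⟨ cong₂ (upperBlock 1ℤ)
           (trans (cong₂ addV (scaleV-identityˡ r) sN′≡-r) (addV-inverseʳ r))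
           M′N′≡I ⟩
    upperBlock 1ℤ zeroV identityM
      ≡⟨ identityM-upperBlock ⟨
    identityM ∎

-- Lattices spanned by the rows of an upper triangular matrix

inLattice-head : ∀ {n} (v : Vecℤ (suc n)) (M : Vec (Vecℤ (suc n)) n) → InLattice (v ∷ M) v
inLattice-head v M = 1ℤ ∷ zeroV , sym (linComb-head v M)

inLattice-upperBlock⁺ : ∀ {n x r} {M : Mat n} {v} → InLattice M v → InLattice (upperBlock x r M) (0ℤ ∷ v)
inLattice-upperBlock⁺ {x = x} {r} {M} {v} (c , v≡cM) = 0ℤ ∷ c , (begin
  0ℤ ∷ v                                    ≡⟨ cong (0ℤ ∷_) v≡cM ⟩
  0ℤ ∷ linComb c M                          ≡⟨ linComb-shift c M ⟨
  linComb c (map (0ℤ ∷_) M)                 ≡⟨ linComb-tail c (x ∷ r) (map (0ℤ ∷_) M) ⟨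
  linComb (0ℤ ∷ c) (upperBlock x r M)       ∎)

inLattice-upperBlock⁻ : ∀ {n x r} {M : Mat n} {z v} → InLattice (upperBlock x r M) (z ∷ v) →
  Σ ℤ λ c₀ → Σ (Vecℤ n) λ c → z ≡ c₀ * x × v ≡ addV (scaleV c₀ r) (linComb c M)
inLattice-upperBlock⁻ {x = x} {r} {M} (c₀ ∷ c , zv≡)
  with Vec.∷-injective (trans zv≡ (cong (addV (scaleV c₀ (x ∷ r))) (linComb-shift c M)))
... | z≡ , v≡ = c₀ , c , trans z≡ (ℤ.+-identityʳ (c₀ * x)) , v≡

inLattice-upperBlock-zero⁻ : ∀ {n x r} {M : Mat n} {v} → x ≢ 0ℤ →
  InLattice (upperBlock x r M) (0ℤ ∷ v) → InLattice M v
inLattice-upperBlock-zero⁻ {x = x} {r} {M} {v} x≢0 v∈ with inLattice-upperBlock⁻ v∈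
... | c₀ , c , 0≡c₀x , v≡ = c , (begin
  v                                     ≡⟨ v≡ ⟩
  addV (scaleV c₀ r) (linComb c M)      ≡⟨ cong (λ k → addV (scaleV k r) (linComb c M)) c₀≡0 ⟩
  addV (scaleV 0ℤ r) (linComb c M)      ≡⟨ linComb-tail c r M ⟩
  linComb c M                           ∎)
  where
  c₀≡0 : c₀ ≡ 0ℤ
  c₀≡0 = ℤ.*-cancelʳ-≡ c₀ 0ℤ x {{≢-nonZero x≢0}} (trans (sym 0≡c₀x) (sym (ℤ.*-zeroˡ x)))

ShiftClosed : ∀ {n} → Mat (suc n) → Set
ShiftClosed B = ∀ v → InLattice B (0ℤ ∷ v) → InLattice B (v ∷ʳ 0ℤ)

shiftClosed-upperBlock : ∀ {n x r} {M : Mat (suc n)} → x ≢ 0ℤ → ShiftClosed (upperBlock x r M) → ShiftClosed M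
shiftClosed-upperBlock x≢0 closed v v∈M =
  inLattice-upperBlock-zero⁻ x≢0 (closed (0ℤ ∷ v) (inLattice-upperBlock⁺ v∈M))

mulα-shift : ∀ {n} (a : Vecℤ (suc n)) (v : Vecℤ n) → mulα a (0ℤ ∷ v) ≡ v ∷ʳ 0ℤ
mulα-shift a v = minus-zero (v ∷ʳ 0ℤ) a
  where
  minus-zero : ∀ {n} (u a : Vecℤ n) → zipWith (λ x aᵢ → x - aᵢ * 0ℤ) u a ≡ u
  minus-zero []      []      = refl
  minus-zero (x ∷ u) (aᵢ ∷ a) =
    cong₂ _∷_ (trans (cong (x -_) (ℤ.*-zeroʳ aᵢ)) (ℤ.+-identityʳ x)) (minus-zero u a)

mulα-zeroV : ∀ {n} (a : Vecℤ n) → mulα a zeroV ≡ zeroV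
mulα-zeroV {zero}  a = refl
mulα-zeroV {suc n} a = trans (mulα-shift a zeroV) (zeroV-∷ʳ n)
  where
  zeroV-∷ʳ : ∀ n → replicate n 0ℤ ∷ʳ 0ℤ ≡ zeroV
  zeroV-∷ʳ zero    = refl
  zeroV-∷ʳ (suc n) = cong (0ℤ ∷_) (zeroV-∷ʳ n)

α : ∀ n → Vecℤ (suc (suc n))
α zero    = 1ℤ ∷ 0ℤ ∷ []
α (suc n) = 0ℤ ∷ α n

hornerAcc-α : ∀ {d} k (a x : Vecℤ d) → hornerAcc a x zeroV (α k) ≡ mulα a x
hornerAcc-α zero a x = begin
  addV (mulα a (addV (mulα a zeroV) (scaleV 1ℤ x))) (scaleV 0ℤ x)
    ≡⟨ cong₂ (λ u w → addV (mulα a (addV u w)) (scaleV 0ℤ x)) (mulα-zeroV a) (scaleV-identityˡ x) ⟩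
  addV (mulα a (addV zeroV x)) (scaleV 0ℤ x)
    ≡⟨ cong₂ (λ u w → addV (mulα a u) w) (addV-identityˡ x) (scaleV-zeroˡ x) ⟩
  addV (mulα a x) zeroV
    ≡⟨ addV-identityʳ (mulα a x) ⟩
  mulα a x ∎
hornerAcc-α (suc k) a x = begin
  hornerAcc a x (addV (mulα a zeroV) (scaleV 0ℤ x)) (α k)
    ≡⟨ cong (λ acc → hornerAcc a x acc (α k))
         (trans (cong₂ addV (mulα-zeroV a) (scaleV-zeroˡ x)) (addV-identityˡ zeroV)) ⟩
  hornerAcc a x zeroV (α k)
    ≡⟨ hornerAcc-α k a x ⟩
  mulα a x ∎

isIdeal⇒shiftClosed : ∀ {n} (a : Vecℤ (suc (suc n))) (B : Mat (suc (suc n))) → IsIdeal a B → ShiftClosed B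
isIdeal⇒shiftClosed {n} a B ideal v v∈B =
  subst (InLattice B) (trans (hornerAcc-α n a (0ℤ ∷ v)) (mulα-shift a v)) (ideal (α n) (0ℤ ∷ v) v∈B)

∣ˢ0 : ∀ g → g ∣ˢ 0ℤ
∣ˢ0 g = divides 0ℤ (sym (ℤ.*-zeroˡ g))

∣-zeroV : ∀ {n} g → All (g ∣ˢ_) (zeroV {n})
∣-zeroV {zero}  g = []
∣-zeroV {suc n} g = ∣ˢ0 g ∷ ∣-zeroV g

∣-∷ʳ : ∀ {n g x} {v : Vecℤ n} → All (g ∣ˢ_) v → g ∣ˢ x → All (g ∣ˢ_) (v ∷ʳ x)
∣-∷ʳ []         g∣x = g∣x ∷ []
∣-∷ʳ (g∣y ∷ g∣v) g∣x = g∣y ∷ ∣-∷ʳ g∣v g∣x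

∣-addV-cancelʳ : ∀ {n g} {u v : Vecℤ n} → All (g ∣ˢ_) (addV u v) → All (g ∣ˢ_) v → All (g ∣ˢ_) u
∣-addV-cancelʳ {u = []}    {[]}    []             []           = []
∣-addV-cancelʳ {u = _ ∷ _} {_ ∷ _} (g∣x+y ∷ g∣u+v) (g∣y ∷ g∣v) =
  Signed.∣m+n∣n⇒∣m g∣x+y g∣y ∷ ∣-addV-cancelʳ g∣u+v g∣v

∣-addV : ∀ {n g} {u v : Vecℤ n} → All (g ∣ˢ_) u → All (g ∣ˢ_) v → All (g ∣ˢ_) (addV u v)
∣-addV []           []           = []
∣-addV (g∣x ∷ g∣u) (g∣y ∷ g∣v) = Signed.∣m∣n⇒∣m+n g∣x g∣y ∷ ∣-addV g∣u g∣v

∣-scaleV : ∀ {n g} c {v : Vecℤ n} → All (g ∣ˢ_) v → All (g ∣ˢ_) (scaleV c v)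
∣-scaleV c = All.gmap (Signed.∣n⇒∣m*n c)

∣-linComb : ∀ {m d g} (c : Vecℤ m) {M : Vec (Vecℤ d) m} → All (All (g ∣ˢ_)) M → All (g ∣ˢ_) (linComb c M)
∣-linComb []      []            = ∣-zeroV _
∣-linComb (x ∷ c) (g∣v ∷ g∣M) = ∣-addV (∣-scaleV x g∣v) (∣-linComb c g∣M)

DiagonalDividesLowerRows : ∀ {n} → Mat n → Set
DiagonalDividesLowerRows B = ∀ i l j → toℕ i ≤ toℕ l → entry B i i ∣ˢ entry B l j

shiftClosed⇒topLeft∣ : ∀ {n x r y s} {M : Mat n} → ShiftClosed (upperBlock x r (upperBlock y s M)) → y ≢ 0ℤ →
  All (All (y ∣ˢ_)) (upperBlock y s M) → x ∣ˢ y × All (x ∣ˢ_) r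
shiftClosed⇒topLeft∣ {x = x} {r} {y} {s} {M} closed y≢0 y∣M
  with inLattice-upperBlock⁻
         (closed (y ∷ s) (inLattice-upperBlock⁺ (inLattice-head (y ∷ s) (map (0ℤ ∷_) M))))
... | c₀ , c , y≡c₀x , s0≡ =
  divides c₀ y≡c₀x , All.map (cancel ∘ subst (_∣ˢ _) y≡c₀x) (All.map⁻ y∣c₀r)
  where
  y∣c₀r : All (y ∣ˢ_) (scaleV c₀ r)
  y∣c₀r = ∣-addV-cancelʳ (subst (All (y ∣ˢ_)) s0≡ (∣-∷ʳ (All.tail (All.head y∣M)) (∣ˢ0 y)))
                         (∣-linComb c y∣M)
  c₀≢0 : c₀ ≢ 0ℤ
  c₀≢0 c₀≡0 = y≢0 (trans y≡c₀x (trans (cong (_* x) c₀≡0) (ℤ.*-zeroˡ x)))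
  cancel : ∀ {k} → c₀ * x ∣ˢ c₀ * k → x ∣ˢ k
  cancel = Signed.*-cancelˡ-∣ c₀ {{≢-nonZero c₀≢0}}

diagonalDividesLowerRows-upperBlock : ∀ {n x r} {M : Mat (suc n)} → DiagonalDividesLowerRows M →
  x ∣ˢ entry M zero zero → All (x ∣ˢ_) r → DiagonalDividesLowerRows (upperBlock x r M)
diagonalDividesLowerRows-upperBlock {x = x} {r} {M} dM x∣m₀₀ x∣r = divides-below
  where
  lowerRow : ∀ {g} l → (∀ j → g ∣ˢ entry M l j) → ∀ j → g ∣ˢ entry (upperBlock x r M) (suc l) j
  lowerRow {g} l g∣row j = subst (g ∣ˢ_) (sym (entry-upperBlock-suc x r M l j)) (padded j)
    where
    padded : ∀ j → g ∣ˢ lookup (0ℤ ∷ lookup M l) j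
    padded zero    = ∣ˢ0 g
    padded (suc j) = g∣row j
  divides-below : DiagonalDividesLowerRows (upperBlock x r M)
  divides-below zero    zero    zero    _         = Signed.∣-refl
  divides-below zero    zero    (suc j) _         = All.lookup⁺ x∣r j
  divides-below zero    (suc l) j       _         = lowerRow l (λ j → Signed.∣-trans x∣m₀₀ (dM zero l j z≤n)) j
  divides-below (suc i) (suc l) j       (s≤s i≤l) =
    subst (_∣ˢ _) (sym (entry-upperBlock-suc x r M i (suc i))) (lowerRow l (λ j → dM i l j i≤l) j)

shiftClosed⇒diagonalDividesLowerRows : ∀ {n} {B : Mat (suc n)} → UpperTriangular (_≢ 0ℤ) B → ShiftClosed B →
  DiagonalDividesLowerRows B
shiftClosed⇒diagonalDividesLowerRows (_ ∷ [])                        _      zero zero zero _ = Signed.∣-refl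
shiftClosed⇒diagonalDividesLowerRows (_∷_ {x = x} {r} {M} x≢0 M-triangular@(_∷_ {x = y} y≢0 _)) closed =
  diagonalDividesLowerRows-upperBlock dM (proj₁ x∣y×x∣r) (proj₂ x∣y×x∣r)
  where
  dM : DiagonalDividesLowerRows M
  dM = shiftClosed⇒diagonalDividesLowerRows M-triangular (shiftClosed-upperBlock x≢0 closed)
  x∣y×x∣r : x ∣ˢ y × All (x ∣ˢ_) r
  x∣y×x∣r = shiftClosed⇒topLeft∣ closed y≢0 (All.lookup⁻ λ l → All.lookup⁻ λ j → dM zero l j z≤n)

-- Smith form

diagonalQuotient : ∀ {n} (B : Mat n) → (∀ i j → entry B i i ∣ˢ entry B i j) → Mat n
diagonalQuotient B div = tabulate λ i → tabulate λ j → Signed.quotient (div i j)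

module _ {n} (B : Mat n) (div : ∀ i j → entry B i i ∣ˢ entry B i j) where

  private
    N : Mat n
    N = diagonalQuotient B div

  entry-diagonalQuotient : ∀ i j → entry N i j ≡ Signed.quotient (div i j)
  entry-diagonalQuotient i j =
    trans (cong (λ v → lookup v j) (Vec.lookup∘tabulate _ i)) (Vec.lookup∘tabulate _ j)

  row-diagonalQuotient : ∀ i → lookup B i ≡ scaleV (entry B i i) (lookup N i)
  row-diagonalQuotient i = lookup-ext λ j → begin
    entry B i j                                   ≡⟨ Signed._∣_.equality (div i j) ⟩
    Signed.quotient (div i j) * entry B i i       ≡⟨ ℤ.*-comm _ (entry B i i) ⟩
    entry B i i * Signed.quotient (div i j)       ≡⟨ cong (entry B i i *_) (entry-diagonalQuotient i j) ⟨
    entry B i i * entry N i j                     ≡⟨ Vec.lookup-map j (entry B i i *_) (lookup N i) ⟨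
    lookup (scaleV (entry B i i) (lookup N i)) j  ∎

  diagonalQuotient-unitriangular : (∀ i j → toℕ j N.< toℕ i → entry B i j ≡ 0ℤ) →
    (∀ i → entry B i i ≢ 0ℤ) → Unitriangular N
  diagonalQuotient-unitriangular lower nonzero = upperTriangular N
    (λ i j j<i → quotient≡ i j 0ℤ (trans (lower i j j<i) (sym (ℤ.*-zeroˡ (entry B i i)))))
    (λ i → quotient≡ i i 1ℤ (sym (ℤ.*-identityˡ (entry B i i))))
    where
    quotient≡ : ∀ i j c → entry B i j ≡ c * entry B i i → entry N i j ≡ c
    quotient≡ i j c eq = trans (entry-diagonalQuotient i j)
      (ℤ.*-cancelʳ-≡ _ c (entry B i i) {{≢-nonZero (nonzero i)}}
        (trans (sym (Signed._∣_.equality (div i j))) eq))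

*-indicator : ∀ k (b : Bool) → k * (if b then 1ℤ else 0ℤ) ≡ (if b then k else 0ℤ)
*-indicator k true  = ℤ.*-identityʳ k
*-indicator k false = ℤ.*-zeroʳ k

scaleV-identityRow : ∀ {n} (B : Mat n) i → scaleV (entry B i i) (lookup identityM i) ≡ lookup (diagOf B) i
scaleV-identityRow B i = begin
  scaleV (entry B i i) (lookup identityM i)
    ≡⟨ cong (scaleV (entry B i i)) (Vec.lookup∘tabulate _ i) ⟩
  map (entry B i i *_) (tabulate λ j → if ⌊ i ≟ j ⌋ then 1ℤ else 0ℤ)
    ≡⟨ Vec.tabulate-∘ (entry B i i *_) _ ⟨
  tabulate (λ j → entry B i i * (if ⌊ i ≟ j ⌋ then 1ℤ else 0ℤ))
    ≡⟨ Vec.tabulate-cong (λ j → *-indicator (entry B i i) ⌊ i ≟ j ⌋) ⟩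
  tabulate (λ j → if ⌊ i ≟ j ⌋ then entry B i i else 0ℤ)
    ≡⟨ Vec.lookup∘tabulate _ i ⟨
  lookup (diagOf B) i ∎

matMul-diagonal : ∀ {n} (B N V : Mat n) → (∀ i → lookup B i ≡ scaleV (entry B i i) (lookup N i)) →
  matMul N V ≡ identityM → matMul B V ≡ diagOf B
matMul-diagonal B N V rows NV≡I = lookup-ext λ i → begin
  lookup (matMul B V) i                          ≡⟨ Vec.lookup-map i _ B ⟩
  linComb (lookup B i) V                         ≡⟨ cong (λ c → linComb c V) (rows i) ⟩
  linComb (scaleV (entry B i i) (lookup N i)) V  ≡⟨ linComb-scaleV (entry B i i) (lookup N i) V ⟩
  scaleV (entry B i i) (linComb (lookup N i) V)  ≡⟨ cong (scaleV (entry B i i)) (Vec.lookup-map i _ N) ⟨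
  scaleV (entry B i i) (lookup (matMul N V) i)   ≡⟨ cong (λ M → scaleV (entry B i i) (lookup M i)) NV≡I ⟩
  scaleV (entry B i i) (lookup identityM i)      ≡⟨ scaleV-identityRow B i ⟩
  lookup (diagOf B) i                            ∎

unimodular-identityM : ∀ {n} → Unimodular (identityM {n})
unimodular-identityM = identityM , matMul-identityˡ identityM , matMul-identityˡ identityM

unimodular-inverse : ∀ {n} {U : Mat n} (U-unimodular : Unimodular U) → Unimodular (proj₁ U-unimodular)
unimodular-inverse {U = U} (_ , UU′≡I , U′U≡I) = U , U′U≡I , UU′≡I

proposition1 : (d : ℕ) → 2 ≤ d → (a : Vecℤ d) → IrreducibleMonic a →
  (B : Mat d) →
  (∀ (i j : Fin d) → toℕ j N.< toℕ i → entry B i j ≡ 0ℤ) →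
  (∀ (j : Fin d) → 0ℤ Z.< entry B j j) →
  (∀ (i j : Fin d) → toℕ i N.< toℕ j → (0ℤ Z.≤ entry B i j) × (entry B i j Z.< entry B j j)) →
  IsIdeal a B →
  (∀ (i j : Fin d) → toℕ i ≤ toℕ j → (entry B i i ∣ entry B i j) × (entry B i i ∣ entry B j j))
  × (Σ (Mat d) λ U → Σ (Mat d) λ V → Unimodular U × Unimodular V × (matMul (matMul U B) V ≡ diagOf B))
proposition1 (suc (suc n)) (s≤s (s≤s z≤n)) a _ B lower positive _ ideal =
  (λ i j i≤j → Signed.∣⇒∣ᵤ (pivots i i j ≤-refl) , Signed.∣⇒∣ᵤ (pivots i j j i≤j)) ,
  identityM , V , unimodular-identityM , unimodular-inverse N-unimodular , (begin
    matMul (matMul identityM B) V  ≡⟨ cong (λ M → matMul M V) (matMul-identityˡ B) ⟩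
    matMul B V                     ≡⟨ matMul-diagonal B N V (row-diagonalQuotient B rowDiv) NV≡I ⟩
    diagOf B                       ∎)
  where
  nonzero : ∀ i → entry B i i ≢ 0ℤ
  nonzero i = ≢-sym (ℤ.<⇒≢ (positive i))
  pivots : DiagonalDividesLowerRows B
  pivots = shiftClosed⇒diagonalDividesLowerRows (upperTriangular B lower nonzero) (isIdeal⇒shiftClosed a B ideal)
  rowDiv : ∀ i j → entry B i i ∣ˢ entry B i j
  rowDiv i j = pivots i i j ≤-refl
  N : Mat (suc (suc n))
  N = diagonalQuotient B rowDiv
  N-unimodular : Unimodular N
  N-unimodular = unitriangular⇒unimodular (diagonalQuotient-unitriangular B rowDiv lower nonzero)
  V : Mat (suc (suc n))
  V = proj₁ N-unimodular
  NV≡I : matMul N V ≡ identityM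
  NV≡I = proj₁ (proj₂ N-unimodular)
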